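{- There is an absolute constant $d_0$ such that, for any integer $d\geq d_0$, there are sets $F_1,\dots,F_d\subset\{1,\dots,d\}$ such that (i) $|F_k|=\lceil d/2\rceil$ for every $1\leq k\leq d$, and (ii) $|F_k\cap F_{k'}|<7d/26$ for every $1\leq k<k'\leq d$. -}

module Submission where

-- For d ≥ 16^135 + 1 we exhibit d subsets of {0,…,d-1}, each of size ⌈d/2⌉,
-- any two meeting in fewer than 7d/26 elements.  The sets come from ±1
-- vectors with small pairwise correlations:
--
-- * a base code of 16 sign vectors of length 15 whose pairwise inner products
--   lie in [-3, 1] (`baseCode-window`, checked by evaluation);
-- * its t-th tensor power, whose inner products are products of base inner
--   products digit by digit (`corr-suc`); since 3·3 ≤ 15, induction on t
--   keeps 15·⟨w_k, w_k′⟩ in the window [-3·15^t, 15^t] for k ≠ k′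
--   (`corr-window`);
-- * a sign vector w of length n becomes a set of size n inside 2n points by
--   taking, for each y, one point of the pair {2y, 2y+1} according to w_y;
--   two such sets share exactly the agreements of w and w′, which are
--   (n + ⟨w, w′⟩)/2 ≤ 8n/15 in number (`double-overlap`, `agreements-inner`);
-- * writing d = r·2n + s with s < 2n, the k-th set is r copies of the doubled
--   k-th tensor word plus ⌈s/2⌉ of the last s points (`Construction`): its
--   size is rn + ⌈s/2⌉ = ⌈d/2⌉, and two sets meet in at most 8rn/15 + ⌈s/2⌉
--   points, which is below 7d/26 once r ≥ 200 (`margin`);
-- * for d > 16^135 some t satisfies 400·15^t ≤ d ≤ 16^t (`exponent-for`),
--   providing enough words (16^t ≥ d) and copies (r ≥ 200).

open import Data.Nat using (ℕ; _≥_; _<_; _*_; ⌈_/2⌉)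
open import Data.Fin using (Fin) renaming (_<_ to _<ᶠ_)
open import Data.Fin.Subset using (Subset; _∩_; ∣_∣)
open import Data.Product using (∃; Σ-syntax; _×_)
open import Relation.Binary.PropositionalEquality using (_≡_)

open import Data.Nat
  using (zero; suc; _+_; _∸_; _^_; _≤_; _<ᵇ_; _≡ᵇ_; z≤n; s≤s; NonZero; >-nonZero; _/_; _%_)
import Data.Nat.Properties as ℕₚ
open import Data.Nat.DivMod
  using ( _mod_; _divMod_; DivMod; m≡m%n+[m/n]*n; m<n⇒m%n≡m; [m+kn]%n≡m%n; m%n<n
        ; +-distrib-/-∣ʳ; m<n⇒m/n≡0; m*n/n≡m; m<n*o⇒m/o<n; /-monoˡ-≤)
open import Data.Nat.Divisibility using (n∣m*n)
open import Data.Nat.Tactic.RingSolver using (solve-∀)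
open import Data.Integer using (ℤ; +_; -_; -[1+_]; +≤+; -≤+)
  renaming (_+_ to _+ℤ_; _*_ to _*ℤ_; _≤_ to _≤ℤ_; ∣_∣ to ∣_∣ℤ)
import Data.Integer.Properties as ℤₚ
import Data.Integer.Tactic.RingSolver as ℤ-Solver
open import Algebra.Properties.CommutativeSemigroup ℤₚ.+-commutativeSemigroup
  using () renaming (interchange to +-interchange)
open import Data.Fin using (toℕ)
import Data.Fin.Properties as Finₚ
open import Data.Fin.Subset.Properties using (∩-idem)
open import Data.Vec using (Vec; lookup; tabulate; _∷_; [])
open import Data.Bool using (Bool; true; false; not; _∧_; _xor_; if_then_else_)
open import Data.Bool.Properties using (T-≡; ∧-idem)
open import Data.Unit using (tt)
open import Data.Empty using (⊥-elim)
open import Data.Product using (_,_; proj₁; proj₂)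
open import Function.Bundles using (Equivalence)
open import Relation.Nullary using (Dec; yes; no; ¬?)
open import Relation.Nullary.Decidable using (toWitness; _×-dec_; _→-dec_)
open import Relation.Binary.PropositionalEquality
  using (_≢_; refl; sym; trans; cong; cong₂; subst; module ≡-Reasoning)

%-split : ∀ z q m .{{_ : NonZero m}} → z < m → (z + q * m) % m ≡ z
%-split z q m z<m = trans ([m+kn]%n≡m%n z q m) (m<n⇒m%n≡m z<m)

/-split : ∀ z q m .{{_ : NonZero m}} → z < m → (z + q * m) / m ≡ q
/-split z q m z<m = begin
  (z + q * m) / m      ≡⟨ +-distrib-/-∣ʳ z (n∣m*n q) ⟩
  z / m + q * m / m    ≡⟨ cong₂ _+_ (m<n⇒m/n≡0 z<m) (m*n/n≡m q m) ⟩
  q                    ∎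
  where open ≡-Reasoning

digits-injective : ∀ N .{{_ : NonZero N}} k k′ → k mod N ≡ k′ mod N → k / N ≡ k′ / N → k ≡ k′
digits-injective N k k′ same-low same-high = begin
  k                            ≡⟨ DivMod.property (k divMod N) ⟩
  toℕ (k mod N) + k / N * N    ≡⟨ cong₂ (λ a h → toℕ a + h * N) same-low same-high ⟩
  toℕ (k′ mod N) + k′ / N * N  ≡⟨ sym (DivMod.property (k′ divMod N)) ⟩
  k′                           ∎
  where open ≡-Reasoning

leading-part< : ∀ N .{{_ : NonZero N}} t k → k < N ^ suc t → k / N < N ^ t
leading-part< N t k k< = m<n*o⇒m/o<n (subst (k <_) (ℕₚ.*-comm N (N ^ t)) k<)

∑ : ℕ → (ℕ → ℤ) → ℤ
∑ zero    f = + 0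
∑ (suc n) f = f 0 +ℤ ∑ n (λ i → f (suc i))

∑-cong : ∀ n {f g : ℕ → ℤ} → (∀ i → i < n → f i ≡ g i) → ∑ n f ≡ ∑ n g
∑-cong zero    f≗g = refl
∑-cong (suc n) f≗g =
  cong₂ _+ℤ_ (f≗g 0 (s≤s z≤n)) (∑-cong n (λ i i<n → f≗g (suc i) (s≤s i<n)))

∑-++ : ∀ a b (f : ℕ → ℤ) → ∑ (a + b) f ≡ ∑ a f +ℤ ∑ b (λ i → f (a + i))
∑-++ zero    b f = sym (ℤₚ.+-identityˡ _)
∑-++ (suc a) b f =
  trans (cong (f 0 +ℤ_) (∑-++ a b (λ i → f (suc i)))) (sym (ℤₚ.+-assoc (f 0) _ _))

∑-blocks : ∀ r m (f : ℕ → ℤ) → ∑ (r * m) f ≡ ∑ r (λ q → ∑ m (λ z → f (z + q * m)))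
∑-blocks zero    m f = refl
∑-blocks (suc r) m f = begin
  ∑ (m + r * m) f
    ≡⟨ ∑-++ m (r * m) f ⟩
  ∑ m f +ℤ ∑ (r * m) (λ i → f (m + i))
    ≡⟨ cong₂ _+ℤ_ (∑-cong m (λ z _ → cong f (sym (ℕₚ.+-identityʳ z))))
                  (∑-blocks r m (λ i → f (m + i))) ⟩
  ∑ m (λ z → f (z + 0)) +ℤ ∑ r (λ q → ∑ m (λ z → f (m + (z + q * m))))
    ≡⟨ cong (∑ m (λ z → f (z + 0)) +ℤ_)
            (∑-cong r (λ q _ → ∑-cong m (λ z _ → cong f (shift m z (q * m))))) ⟩
  ∑ (suc r) (λ q → ∑ m (λ z → f (z + q * m))) ∎
  where
  open ≡-Reasoning
  shift : ∀ m z x → m + (z + x) ≡ z + (m + x)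
  shift = solve-∀

∑-*ˡ : ∀ n c (f : ℕ → ℤ) → ∑ n (λ i → c *ℤ f i) ≡ c *ℤ ∑ n f
∑-*ˡ zero    c f = sym (ℤₚ.*-zeroʳ c)
∑-*ˡ (suc n) c f =
  trans (cong (c *ℤ f 0 +ℤ_) (∑-*ˡ n c (λ i → f (suc i)))) (sym (ℤₚ.*-distribˡ-+ c (f 0) _))

∑-*ʳ : ∀ n c (f : ℕ → ℤ) → ∑ n (λ i → f i *ℤ c) ≡ ∑ n f *ℤ c
∑-*ʳ n c f = begin
  ∑ n (λ i → f i *ℤ c) ≡⟨ ∑-cong n (λ i _ → ℤₚ.*-comm (f i) c) ⟩
  ∑ n (λ i → c *ℤ f i) ≡⟨ ∑-*ˡ n c f ⟩
  c *ℤ ∑ n f           ≡⟨ ℤₚ.*-comm c (∑ n f) ⟩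
  ∑ n f *ℤ c           ∎
  where open ≡-Reasoning

∑-+ : ∀ n (f g : ℕ → ℤ) → ∑ n (λ i → f i +ℤ g i) ≡ ∑ n f +ℤ ∑ n g
∑-+ zero    f g = refl
∑-+ (suc n) f g =
  trans (cong (f 0 +ℤ g 0 +ℤ_) (∑-+ n (λ i → f (suc i)) (λ i → g (suc i))))
        (+-interchange (f 0) (g 0) _ _)

∑-const : ∀ n c → ∑ n (λ _ → c) ≡ + n *ℤ c
∑-const zero    c = sym (ℤₚ.*-zeroˡ c)
∑-const (suc n) c = begin
  c +ℤ ∑ n (λ _ → c)   ≡⟨ cong (c +ℤ_) (∑-const n c) ⟩
  c +ℤ + n *ℤ c        ≡⟨ cong (_+ℤ + n *ℤ c) (sym (ℤₚ.*-identityˡ c)) ⟩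
  + 1 *ℤ c +ℤ + n *ℤ c ≡⟨ sym (ℤₚ.*-distribʳ-+ c (+ 1) (+ n)) ⟩
  + suc n *ℤ c         ∎
  where open ≡-Reasoning

∑-ones : ∀ n → ∑ n (λ _ → + 1) ≡ + n
∑-ones n = trans (∑-const n (+ 1)) (ℤₚ.*-identityʳ (+ n))

⟦_⟧ : Bool → ℤ
⟦ true  ⟧ = + 1
⟦ false ⟧ = + 0

count : ℕ → (ℕ → Bool) → ℤ
count n p = ∑ n (λ i → ⟦ p i ⟧)

count-below : ∀ s c → c ≤ s → count s (λ i → i <ᵇ c) ≡ + c
count-below s zero z≤n = trans (∑-const s (+ 0)) (ℤₚ.*-zeroʳ (+ s))
count-below (suc s) (suc c) (s≤s c≤s) = cong (+ 1 +ℤ_) (count-below s c c≤s)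

subset : ∀ d → (ℕ → Bool) → Subset d
subset d p = tabulate (λ i → p (toℕ i))

subset-size : ∀ d p → + ∣ subset d p ∣ ≡ count d p
subset-size zero    p = refl
subset-size (suc d) p with p 0 | subset-size d (λ i → p (suc i))
... | true  | ih = cong (+ 1 +ℤ_) ih
... | false | ih = trans ih (sym (ℤₚ.+-identityˡ _))

subset-∩ : ∀ d p q → subset d p ∩ subset d q ≡ subset d (λ i → p i ∧ q i)
subset-∩ zero    p q = refl
subset-∩ (suc d) p q = cong (p 0 ∧ q 0 ∷_) (subset-∩ d (λ i → p (suc i)) (λ i → q (suc i)))

-- Boolean vectors are read as ±1 vectors via `sign`; `same` is the Boolean
-- operation corresponding to multiplication of signs.
sign : Bool → ℤ
sign true  = + 1
sign false = -[1+ 0 ]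

same : Bool → Bool → Bool
same a b = not (a xor b)

sign-same : ∀ a b → sign (same a b) ≡ sign a *ℤ sign b
sign-same true  true  = refl
sign-same true  false = refl
sign-same false true  = refl
sign-same false false = refl

inner : ℕ → (ℕ → Bool) → (ℕ → Bool) → ℤ
inner n u v = ∑ n (λ y → sign (u y) *ℤ sign (v y))

agreements : ℕ → (ℕ → Bool) → (ℕ → Bool) → ℤ
agreements n u v = count n (λ y → same (u y) (v y))

inner-self : ∀ n u → inner n u u ≡ + n
inner-self n u = begin
  inner n u u          ≡⟨ ∑-cong n (λ y _ → sign² (u y)) ⟩
  ∑ n (λ _ → + 1)      ≡⟨ ∑-ones n ⟩
  + n                  ∎
  where
  open ≡-Reasoning
  sign² : ∀ a → sign a *ℤ sign a ≡ + 1
  sign² true  = refl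
  sign² false = refl

agreements-self : ∀ n u → agreements n u u ≡ + n
agreements-self n u = begin
  agreements n u u     ≡⟨ ∑-cong n (λ y _ → cong ⟦_⟧ (same-refl (u y))) ⟩
  ∑ n (λ _ → + 1)      ≡⟨ ∑-ones n ⟩
  + n                  ∎
  where
  open ≡-Reasoning
  same-refl : ∀ a → same a a ≡ true
  same-refl true  = refl
  same-refl false = refl

agreements-inner : ∀ n u v → + 2 *ℤ agreements n u v ≡ + n +ℤ inner n u v
agreements-inner n u v = begin
  + 2 *ℤ agreements n u v
    ≡⟨ sym (∑-*ˡ n (+ 2) _) ⟩
  ∑ n (λ y → + 2 *ℤ ⟦ same (u y) (v y) ⟧)
    ≡⟨ ∑-cong n (λ y _ → pointwise (u y) (v y)) ⟩
  ∑ n (λ y → + 1 +ℤ sign (u y) *ℤ sign (v y))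
    ≡⟨ ∑-+ n _ _ ⟩
  ∑ n (λ _ → + 1) +ℤ inner n u v
    ≡⟨ cong (_+ℤ inner n u v) (∑-ones n) ⟩
  + n +ℤ inner n u v ∎
  where
  open ≡-Reasoning
  pointwise : ∀ a b → + 2 *ℤ ⟦ same a b ⟧ ≡ + 1 +ℤ sign a *ℤ sign b
  pointwise true  true  = refl
  pointwise true  false = refl
  pointwise false true  = refl
  pointwise false false = refl

-- The 0/1 vector of length 2n obtained from w by writing each entry y as
-- the pair (w y, not (w y)).
double : (ℕ → Bool) → ℕ → Bool
double w z = same (z % 2 ≡ᵇ 0) (w (z / 2))

double-pair : ∀ w y e → e < 2 → double w (e + y * 2) ≡ same (e ≡ᵇ 0) (w y)
double-pair w y e e<2 =
  cong₂ (λ x y′ → same (x ≡ᵇ 0) (w y′)) (%-split e y 2 e<2) (/-split e y 2 e<2)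

double-overlap : ∀ n u v →
  count (n * 2) (λ z → double u z ∧ double v z) ≡ agreements n u v
double-overlap n u v = begin
  count (n * 2) (λ z → double u z ∧ double v z)
    ≡⟨ ∑-blocks n 2 _ ⟩
  ∑ n (λ y → count 2 (λ e → double u (e + y * 2) ∧ double v (e + y * 2)))
    ≡⟨ ∑-cong n (λ y _ → trans
         (∑-cong 2 (λ e e<2 → cong₂ (λ a b → ⟦ a ∧ b ⟧) (double-pair u y e e<2) (double-pair v y e e<2)))
         (pair (u y) (v y))) ⟩
  agreements n u v ∎
  where
  open ≡-Reasoning
  pair : ∀ a b → count 2 (λ e → same (e ≡ᵇ 0) a ∧ same (e ≡ᵇ 0) b) ≡ ⟦ same a b ⟧
  pair true  true  = refl
  pair true  false = refl
  pair false true  = refl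
  pair false false = refl

layout : (m r c : ℕ) .{{_ : NonZero m}} → (ℕ → Bool) → ℕ → Bool
layout m r c u p = if p <ᵇ r * m then u (p % m) else (p ∸ r * m <ᵇ c)

layout-block : ∀ m r c .{{_ : NonZero m}} u q z → q < r → z < m →
  layout m r c u (z + q * m) ≡ u z
layout-block m r c u q z q<r z<m = begin
  layout m r c u (z + q * m)  ≡⟨ cong (λ b → if b then u ((z + q * m) % m) else (z + q * m ∸ r * m <ᵇ c))
                                     (Equivalence.to T-≡ (ℕₚ.<⇒<ᵇ inside)) ⟩
  u ((z + q * m) % m)         ≡⟨ cong u (%-split z q m z<m) ⟩
  u z                         ∎
  where
  open ≡-Reasoning
  inside : z + q * m < r * m
  inside = ℕₚ.<-≤-trans (ℕₚ.+-monoˡ-< (q * m) z<m) (ℕₚ.*-monoˡ-≤ m q<r)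

layout-padding : ∀ m r c .{{_ : NonZero m}} u i → layout m r c u (r * m + i) ≡ (i <ᵇ c)
layout-padding m r c u i = begin
  layout m r c u (r * m + i)  ≡⟨ cong (λ b → if b then u ((r * m + i) % m) else (r * m + i ∸ r * m <ᵇ c))
                                     (outside (r * m)) ⟩
  (r * m + i ∸ r * m <ᵇ c)    ≡⟨ cong (_<ᵇ c) (ℕₚ.m+n∸m≡n (r * m) i) ⟩
  (i <ᵇ c)                    ∎
  where
  open ≡-Reasoning
  outside : ∀ a → (a + i <ᵇ a) ≡ false
  outside zero    = refl
  outside (suc a) = outside a

layout-overlap : ∀ m r c s .{{_ : NonZero m}} u v → c ≤ s →
  count (r * m + s) (λ p → layout m r c u p ∧ layout m r c v p)
    ≡ + r *ℤ count m (λ z → u z ∧ v z) +ℤ + c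
layout-overlap m r c s u v c≤s = begin
  ∑ (r * m + s) g
    ≡⟨ ∑-++ (r * m) s g ⟩
  ∑ (r * m) g +ℤ ∑ s (λ i → g (r * m + i))
    ≡⟨ cong (_+ℤ ∑ s (λ i → g (r * m + i))) (∑-blocks r m g) ⟩
  ∑ r (λ q → ∑ m (λ z → g (z + q * m))) +ℤ ∑ s (λ i → g (r * m + i))
    ≡⟨ cong₂ _+ℤ_ (∑-cong r (λ q q<r → ∑-cong m (λ z z<m → cong₂ (λ a b → ⟦ a ∧ b ⟧)
                      (layout-block m r c u q z q<r z<m) (layout-block m r c v q z q<r z<m))))
                  (∑-cong s (λ i _ → cong₂ (λ a b → ⟦ a ∧ b ⟧)
                      (layout-padding m r c u i) (layout-padding m r c v i))) ⟩
  ∑ r (λ _ → count m (λ z → u z ∧ v z)) +ℤ count s (λ i → (i <ᵇ c) ∧ (i <ᵇ c))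
    ≡⟨ cong₂ _+ℤ_ (∑-const r _)
                  (trans (∑-cong s {g = λ i → ⟦ i <ᵇ c ⟧} (λ i _ → cong ⟦_⟧ (∧-idem (i <ᵇ c))))
                         (count-below s c c≤s)) ⟩
  + r *ℤ count m (λ z → u z ∧ v z) +ℤ + c ∎
  where
  open ≡-Reasoning
  g : ℕ → ℤ
  g p = ⟦ layout m r c u p ∧ layout m r c v p ⟧

Window : ℕ → ℕ → ℤ → Set
Window α m X = (- + (α * m) ≤ℤ X) × (X ≤ℤ + m)

window? : ∀ α m X → Dec (Window α m X)
window? α m X = (- + (α * m) ℤₚ.≤? X) ×-dec (X ℤₚ.≤? + m)

window⇒abs : ∀ α m X .{{_ : NonZero α}} → Window α m X → ∣ X ∣ℤ ≤ α * m
window⇒abs α m (+ k)    (_ , k≤m) = ℕₚ.≤-trans (ℤₚ.drop‿+≤+ k≤m) (ℕₚ.m≤n*m m α)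
window⇒abs α m -[1+ k ] (lower , _) = ℤₚ.drop‿+≤+ (ℤₚ.neg-cancel-≤ lower)

abs⇒window : ∀ M X → ∣ X ∣ℤ ≤ M → (- + M ≤ℤ X) × (X ≤ℤ + M)
abs⇒window M (+ k)    k≤M    = ℤₚ.neg-≤-pos , +≤+ k≤M
abs⇒window M -[1+ k ] 1+k≤M = ℤₚ.neg-mono-≤ (+≤+ 1+k≤M) , -≤+

neg-pos-* : ∀ a b → - + (a * b) ≡ + a *ℤ - + b
neg-pos-* a b = trans (cong -_ (ℤₚ.pos-* a b)) (ℤₚ.neg-distribʳ-* (+ a) (+ b))

window-scale : ∀ α L m X → Window α m X → Window α (L * m) (+ L *ℤ X)
window-scale α L m X (lower , upper) =
  subst (_≤ℤ + L *ℤ X) lower≡ (ℤₚ.*-monoˡ-≤-nonNeg (+ L) lower) ,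
  subst (+ L *ℤ X ≤ℤ_) (sym (ℤₚ.pos-* L m)) (ℤₚ.*-monoˡ-≤-nonNeg (+ L) upper)
  where
  reorder : ∀ α L m → L * (α * m) ≡ α * (L * m)
  reorder = solve-∀
  lower≡ : + L *ℤ - + (α * m) ≡ - + (α * (L * m))
  lower≡ = trans (sym (neg-pos-* L (α * m))) (cong (λ x → - + x) (reorder α L m))

window-stretch : ∀ α M J → Window α 1 J → Window α M (J *ℤ + M)
window-stretch α M J (lower , upper) =
  subst (_≤ℤ J *ℤ + M) lower≡ (ℤₚ.*-monoʳ-≤-nonNeg (+ M) lower) ,
  subst (J *ℤ + M ≤ℤ_) (ℤₚ.*-identityˡ (+ M)) (ℤₚ.*-monoʳ-≤-nonNeg (+ M) upper)
  where
  lower≡ : - + (α * 1) *ℤ + M ≡ - + (α * M)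
  lower≡ = begin
    - + (α * 1) *ℤ + M     ≡⟨ sym (ℤₚ.neg-distribˡ-* (+ (α * 1)) (+ M)) ⟩
    - (+ (α * 1) *ℤ + M)   ≡⟨ cong -_ (sym (ℤₚ.pos-* (α * 1) M)) ⟩
    - + (α * 1 * M)        ≡⟨ cong (λ x → - + (x * M)) (ℕₚ.*-identityʳ α) ⟩
    - + (α * M)            ∎
    where open ≡-Reasoning

-- The product of a number in [-α, 1] and a number in [-α·m, m] is at most
-- α²·m in absolute value, hence lies in [-α·L·m, L·m] when α² ≤ L.
window-mix : ∀ α L m J X .{{_ : NonZero α}} → α * α ≤ L →
  Window α 1 J → Window α m X → Window α (L * m) (J *ℤ X)
window-mix α L m J X α²≤L J∈ X∈ =
  ℤₚ.≤-trans (ℤₚ.neg-mono-≤ (+≤+ (ℕₚ.m≤n*m (L * m) α))) lower , upper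
  where
  reorder : ∀ α m → α * 1 * (α * m) ≡ α * α * m
  reorder = solve-∀
  small : ∣ J *ℤ X ∣ℤ ≤ L * m
  small = begin
    ∣ J *ℤ X ∣ℤ           ≡⟨ ℤₚ.abs-* J X ⟩
    ∣ J ∣ℤ * ∣ X ∣ℤ        ≤⟨ ℕₚ.*-mono-≤ (window⇒abs α 1 J J∈) (window⇒abs α m X X∈) ⟩
    α * 1 * (α * m)      ≡⟨ reorder α m ⟩
    α * α * m            ≤⟨ ℕₚ.*-monoˡ-≤ m α²≤L ⟩
    L * m                ∎
    where open ℕₚ.≤-Reasoning
  lower : - + (L * m) ≤ℤ J *ℤ X
  lower = proj₁ (abs⇒window (L * m) (J *ℤ X) small)
  upper : J *ℤ X ≤ℤ + (L * m)
  upper = proj₂ (abs⇒window (L * m) (J *ℤ X) small)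

-- The t-th tensor power of a code of N words of length L: the word with
-- number k (written in base N) has at position y (written in base L) the
-- product of the base-code entries at the corresponding digits.
module TensorPower (N L : ℕ) .{{_ : NonZero N}} .{{_ : NonZero L}} (code : Fin N → ℕ → Bool) where

  word : ℕ → ℕ → ℕ → Bool
  word zero    k y = true
  word (suc t) k y = same (code (k mod N) (y % L)) (word t (k / N) (y / L))

  baseCorr : Fin N → Fin N → ℤ
  baseCorr a b = inner L (code a) (code b)

  corr : ℕ → ℕ → ℕ → ℤ
  corr t k k′ = inner (L ^ t) (word t k) (word t k′)

  corr-suc : ∀ t k k′ → corr (suc t) k k′ ≡ baseCorr (k mod N) (k′ mod N) *ℤ corr t (k / N) (k′ / N)
  corr-suc t k k′ = begin
    ∑ (L * L ^ t) g
      ≡⟨ cong (λ n → ∑ n g) (ℕₚ.*-comm L (L ^ t)) ⟩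
    ∑ (L ^ t * L) g
      ≡⟨ ∑-blocks (L ^ t) L g ⟩
    ∑ (L ^ t) (λ q → ∑ L (λ z → g (z + q * L)))
      ≡⟨ ∑-cong (L ^ t) (λ q _ → ∑-cong L (λ z z<L → digitwise q z z<L)) ⟩
    ∑ (L ^ t) (λ q → ∑ L (λ z → low z *ℤ high q))
      ≡⟨ ∑-cong (L ^ t) (λ q _ → ∑-*ʳ L (high q) low) ⟩
    ∑ (L ^ t) (λ q → baseCorr a a′ *ℤ high q)
      ≡⟨ ∑-*ˡ (L ^ t) (baseCorr a a′) high ⟩
    baseCorr a a′ *ℤ corr t (k / N) (k′ / N) ∎
    where
    open ≡-Reasoning
    a a′ : Fin N
    a  = k mod N
    a′ = k′ mod N
    h h′ : ℕ
    h  = k / N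
    h′ = k′ / N
    g : ℕ → ℤ
    g y = sign (word (suc t) k y) *ℤ sign (word (suc t) k′ y)
    low : ℕ → ℤ
    low z = sign (code a z) *ℤ sign (code a′ z)
    high : ℕ → ℤ
    high q = sign (word t h q) *ℤ sign (word t h′ q)
    interchange : ∀ x y u v → (x *ℤ y) *ℤ (u *ℤ v) ≡ (x *ℤ u) *ℤ (y *ℤ v)
    interchange = ℤ-Solver.solve-∀
    digitwise : ∀ q z → z < L → g (z + q * L) ≡ low z *ℤ high q
    digitwise q z z<L = begin
      g (z + q * L)
        ≡⟨ cong₂ (λ z′ q′ → sign (same (code a z′) (word t h q′)) *ℤ sign (same (code a′ z′) (word t h′ q′)))
                 (%-split z q L z<L) (/-split z q L z<L) ⟩
      sign (same (code a z) (word t h q)) *ℤ sign (same (code a′ z) (word t h′ q))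
        ≡⟨ cong₂ _*ℤ_ (sign-same (code a z) (word t h q)) (sign-same (code a′ z) (word t h′ q)) ⟩
      (sign (code a z) *ℤ sign (word t h q)) *ℤ (sign (code a′ z) *ℤ sign (word t h′ q))
        ≡⟨ interchange (sign (code a z)) (sign (word t h q)) (sign (code a′ z)) (sign (word t h′ q)) ⟩
      low z *ℤ high q ∎

  module _ (α : ℕ) .{{_ : NonZero α}} (α²≤L : α * α ≤ L)
           (base-window : ∀ a b → a ≢ b → Window α 1 (baseCorr a b)) where

    corr-window : ∀ t k k′ → k < N ^ t → k′ < N ^ t → k ≢ k′ → Window α (L ^ t) (+ L *ℤ corr t k k′)
    corr-window zero    zero    zero     _         _          k≢k′ = ⊥-elim (k≢k′ refl)
    corr-window zero    (suc k) _        (s≤s ())  _          _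
    corr-window zero    zero    (suc k′) _         (s≤s ())   _
    corr-window (suc t) k       k′       k<        k′<        k≢k′ =
      subst (Window α (L ^ suc t)) (cong (+ L *ℤ_) (sym (corr-suc t k k′))) digit-cases
      where
      open ≡-Reasoning
      a a′ : Fin N
      a  = k mod N
      a′ = k′ mod N
      h h′ : ℕ
      h  = k / N
      h′ = k′ / N
      J I : ℤ
      J = baseCorr a a′
      I = corr t h h′
      induction-hypothesis : h ≢ h′ → Window α (L ^ t) (+ L *ℤ I)
      induction-hypothesis = corr-window t h h′ (leading-part< N t k k<) (leading-part< N t k′ k′<)
      commute : ∀ x y z → x *ℤ (y *ℤ z) ≡ y *ℤ (x *ℤ z)
      commute = ℤ-Solver.solve-∀
      low-equal : a ≡ a′ → J ≡ + L
      low-equal a≡a′ = trans (cong (baseCorr a) (sym a≡a′)) (inner-self L (code a))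
      high-equal : h ≡ h′ → J *ℤ + (L * L ^ t) ≡ + L *ℤ (J *ℤ I)
      high-equal h≡h′ = begin
        J *ℤ + (L * L ^ t)      ≡⟨ cong (J *ℤ_) (ℤₚ.pos-* L (L ^ t)) ⟩
        J *ℤ (+ L *ℤ + L ^ t)   ≡⟨ commute J (+ L) (+ L ^ t) ⟩
        + L *ℤ (J *ℤ + L ^ t)   ≡⟨ cong (λ x → + L *ℤ (J *ℤ x))
                                     (trans (sym (inner-self (L ^ t) (word t h))) (cong (corr t h) h≡h′)) ⟩
        + L *ℤ (J *ℤ I)         ∎
      digit-cases : Window α (L * L ^ t) (+ L *ℤ (J *ℤ I))
      digit-cases with a Finₚ.≟ a′ | h ℕₚ.≟ h′
      ... | yes a≡a′ | yes h≡h′ = ⊥-elim (k≢k′ (digits-injective N k k′ a≡a′ h≡h′))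
      ... | yes a≡a′ | no  h≢h′ =
        subst (λ J′ → Window α (L * L ^ t) (+ L *ℤ (J′ *ℤ I))) (sym (low-equal a≡a′))
          (window-scale α L (L ^ t) _ (induction-hypothesis h≢h′))
      ... | no  a≢a′ | yes h≡h′ =
        subst (Window α (L * L ^ t)) (high-equal h≡h′)
          (window-stretch α (L * L ^ t) J (base-window a a′ a≢a′))
      ... | no  a≢a′ | no  h≢h′ =
        subst (Window α (L * L ^ t)) (commute J (+ L) I)
          (window-mix α L (L ^ t) J (+ L *ℤ I) α²≤L (base-window a a′ a≢a′) (induction-hypothesis h≢h′))

testBit : ℕ → ℕ → Bool
testBit x zero    = x % 2 ≡ᵇ 1
testBit x (suc z) = testBit (x / 2) z

-- The base code: 16 words of length 15, given by the binary expansions of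
-- these numbers.
baseTable : Vec ℕ 16
baseTable = 15389 ∷ 18582 ∷ 4919 ∷ 32467 ∷ 1732 ∷ 20729 ∷ 24494 ∷ 22853 ∷
            2904 ∷ 17419 ∷ 10863 ∷ 11681 ∷ 25974 ∷ 25501 ∷ 29184 ∷ 12746 ∷ []

baseCode : Fin 16 → ℕ → Bool
baseCode a = testBit (lookup baseTable a)

open TensorPower 16 15 baseCode using (baseCorr; word; corr; corr-window)

baseCode-window : ∀ a b → a ≢ b → Window 3 1 (baseCorr a b)
baseCode-window = toWitness {a? = Finₚ.all? (λ a → Finₚ.all? (λ b →
                    ¬? (a Finₚ.≟ b) →-dec window? 3 1 (baseCorr a b)))} tt

⌈even+s/2⌉ : ∀ a s → ⌈ a * 2 + s /2⌉ ≡ a + ⌈ s /2⌉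
⌈even+s/2⌉ zero    s = refl
⌈even+s/2⌉ (suc a) s = cong suc (⌈even+s/2⌉ a s)

⌈s/2⌉≤n : ∀ n s → s < n * 2 → ⌈ s /2⌉ ≤ n
⌈s/2⌉≤n n s s<2n = subst (⌈ s /2⌉ ≤_) (sym (ℕₚ.n≡⌈n+n/2⌉ n))
  (ℕₚ.⌈n/2⌉-mono (subst (s ≤_) (twice n) (ℕₚ.<⇒≤ s<2n)))
  where
  twice : ∀ n → n * 2 ≡ n + n
  twice = solve-∀

overlap-bound : ∀ X r A c n I → + X ≡ + r *ℤ A +ℤ + c → + 2 *ℤ A ≡ + n +ℤ I →
  + 15 *ℤ I ≤ℤ + n → 30 * X ≤ 16 * (r * n) + 30 * c
overlap-bound X r A c n I X≡ 2A≡ 15I≤n = ℤₚ.drop‿+≤+ (begin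
  + (30 * X)
    ≡⟨ trans (ℤₚ.pos-* 30 X) (cong (+ 30 *ℤ_) X≡) ⟩
  + 30 *ℤ (+ r *ℤ A +ℤ + c)
    ≡⟨ regroup (+ r) A (+ c) ⟩
  + r *ℤ (+ 15 *ℤ (+ 2 *ℤ A)) +ℤ + 30 *ℤ + c
    ≡⟨ cong (λ x → + r *ℤ (+ 15 *ℤ x) +ℤ + 30 *ℤ + c) 2A≡ ⟩
  + r *ℤ (+ 15 *ℤ (+ n +ℤ I)) +ℤ + 30 *ℤ + c
    ≡⟨ distribute (+ r) (+ n) I (+ c) ⟩
  + r *ℤ (+ 15 *ℤ + n +ℤ + 15 *ℤ I) +ℤ + 30 *ℤ + c
    ≤⟨ ℤₚ.+-monoˡ-≤ (+ 30 *ℤ + c) (ℤₚ.*-monoˡ-≤-nonNeg (+ r) (ℤₚ.+-monoʳ-≤ (+ 15 *ℤ + n) 15I≤n)) ⟩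
  + r *ℤ (+ 15 *ℤ + n +ℤ + n) +ℤ + 30 *ℤ + c
    ≡⟨ collect (+ r) (+ n) (+ c) ⟩
  + 16 *ℤ (+ r *ℤ + n) +ℤ + 30 *ℤ + c
    ≡⟨ sym (trans (ℤₚ.pos-+ (16 * (r * n)) (30 * c))
                  (cong₂ _+ℤ_ (trans (ℤₚ.pos-* 16 (r * n)) (cong (+ 16 *ℤ_) (ℤₚ.pos-* r n)))
                              (ℤₚ.pos-* 30 c))) ⟩
  + (16 * (r * n) + 30 * c) ∎)
  where
  open ℤₚ.≤-Reasoning
  regroup : ∀ r A c → + 30 *ℤ (r *ℤ A +ℤ c) ≡ r *ℤ (+ 15 *ℤ (+ 2 *ℤ A)) +ℤ + 30 *ℤ c
  regroup = ℤ-Solver.solve-∀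
  distribute : ∀ r n I c → r *ℤ (+ 15 *ℤ (n +ℤ I)) +ℤ + 30 *ℤ c ≡ r *ℤ (+ 15 *ℤ n +ℤ + 15 *ℤ I) +ℤ + 30 *ℤ c
  distribute = ℤ-Solver.solve-∀
  collect : ∀ r n c → r *ℤ (+ 15 *ℤ n +ℤ n) +ℤ + 30 *ℤ c ≡ + 16 *ℤ (r *ℤ n) +ℤ + 30 *ℤ c
  collect = ℤ-Solver.solve-∀

-- The slack behind the constant 7/26: since 16/30 < 14/26, the bound above
-- gives 26·X < 14·r·n once the r·n term dominates the padding (r ≥ 200).
margin : ∀ X r n c → 30 * X ≤ 16 * (r * n) + 30 * c → c ≤ n → 1 ≤ n → 200 ≤ r →
  26 * X < 14 * (r * n)
margin X r n c 30X≤ c≤n 1≤n 200≤r = ℕₚ.*-cancelˡ-< 15 (26 * X) (14 * (r * n)) (begin-strict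
  15 * (26 * X)                 ≡⟨ regroup X ⟩
  13 * (30 * X)                 ≤⟨ ℕₚ.*-monoʳ-≤ 13 30X≤ ⟩
  13 * (16 * (r * n) + 30 * c)  ≡⟨ expand (r * n) c ⟩
  208 * (r * n) + 390 * c       ≤⟨ ℕₚ.+-monoʳ-≤ (208 * (r * n)) (ℕₚ.*-monoʳ-≤ 390 c≤n) ⟩
  208 * (r * n) + 390 * n       <⟨ ℕₚ.+-monoʳ-< (208 * (r * n)) (ℕₚ.*-monoˡ-< n {390} {400} (ℕₚ.m≤m+n 391 9)) ⟩
  208 * (r * n) + 400 * n       ≡⟨ cong (λ x → 208 * (r * n) + x) (halve n) ⟩
  208 * (r * n) + 2 * (200 * n) ≤⟨ ℕₚ.+-monoʳ-≤ (208 * (r * n)) (ℕₚ.*-monoʳ-≤ 2 (ℕₚ.*-monoˡ-≤ n 200≤r)) ⟩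
  208 * (r * n) + 2 * (r * n)   ≡⟨ collect (r * n) ⟩
  15 * (14 * (r * n))           ∎)
  where
  open ℕₚ.≤-Reasoning
  instance
    n-nonZero : NonZero n
    n-nonZero = >-nonZero 1≤n
  regroup : ∀ X → 15 * (26 * X) ≡ 13 * (30 * X)
  regroup = solve-∀
  expand : ∀ P c → 13 * (16 * P + 30 * c) ≡ 208 * P + 390 * c
  expand = solve-∀
  collect : ∀ P → 208 * P + 2 * P ≡ 15 * (14 * P)
  collect = solve-∀
  halve : ∀ n → 400 * n ≡ 2 * (200 * n)
  halve = solve-∀

bracket : ∀ (f : ℕ → ℕ) u d → f 0 < d → d ≤ f u → ∃ λ v → f v < d × d ≤ f (suc v)
bracket f zero    d f0<d d≤f0 = ⊥-elim (ℕₚ.<⇒≱ f0<d d≤f0)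
bracket f (suc u) d f0<d d≤fu+1 with d ℕₚ.≤? f u
... | yes d≤fu = bracket f u d f0<d d≤fu
... | no  d≰fu = u , ℕₚ.≰⇒> d≰fu , d≤fu+1

n<b^n : ∀ b n → 2 ≤ b → n < b ^ n
n<b^n b zero    2≤b = s≤s z≤n
n<b^n b (suc n) 2≤b = begin-strict
  suc n            ≤⟨ n<b^n b n 2≤b ⟩
  b ^ n            <⟨ ℕₚ.m<m+n (b ^ n) (ℕₚ.m^n>0 b n) ⟩
  b ^ n + b ^ n    ≡⟨ twice (b ^ n) ⟩
  2 * b ^ n        ≤⟨ ℕₚ.*-monoˡ-≤ (b ^ n) 2≤b ⟩
  b * b ^ n        ∎
  where
  open ℕₚ.≤-Reasoning
  instance
    b-nonZero : NonZero b
    b-nonZero = >-nonZero (ℕₚ.<-trans (s≤s z≤n) 2≤b)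
  twice : ∀ x → x + x ≡ 2 * x
  twice = solve-∀

power-gap : ∀ K a b U → a ≤ b → K * a ^ suc U ≤ b ^ U → ∀ v → K * a ^ suc (v + U) ≤ b ^ (v + U)
power-gap K a b U a≤b gap zero    = gap
power-gap K a b U a≤b gap (suc v) = begin
  K * (a * a ^ suc (v + U))  ≡⟨ swap K a (a ^ suc (v + U)) ⟩
  a * (K * a ^ suc (v + U))  ≤⟨ ℕₚ.*-monoʳ-≤ a (power-gap K a b U a≤b gap v) ⟩
  a * b ^ (v + U)            ≤⟨ ℕₚ.*-monoˡ-≤ (b ^ (v + U)) a≤b ⟩
  b * b ^ (v + U)            ∎
  where
  open ℕₚ.≤-Reasoning
  swap : ∀ x y z → x * (y * z) ≡ y * (x * z)
  swap = solve-∀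

-- Beyond 16^135 every d lies in a range 400·15^t ≤ d ≤ 16^t: take the t
-- with 16^(t-1) < d ≤ 16^t and use 400·15^136 ≤ 16^135.
exponent-for : ∀ d → 16 ^ 135 < d → ∃ λ t → 400 * 15 ^ t ≤ d × d ≤ 16 ^ t
exponent-for d 16^135<d =
  let (v , below , above) = bracket (λ v → 16 ^ (v + 135)) d d 16^135<d d≤16^[d+135]
  in suc (v + 135) , ℕₚ.≤-trans (power-gap 400 15 16 135 (ℕₚ.n≤1+n 15) base-gap v) (ℕₚ.<⇒≤ below) , above
  where
  d≤16^[d+135] : d ≤ 16 ^ (d + 135)
  d≤16^[d+135] = ℕₚ.≤-trans (ℕₚ.<⇒≤ (n<b^n 16 d (s≤s (s≤s z≤n)))) (ℕₚ.^-monoʳ-≤ 16 (ℕₚ.m≤m+n d 135))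
  base-gap : 400 * 15 ^ 136 ≤ 16 ^ 135
  base-gap = ℕₚ.≤ᵇ⇒≤ (400 * 15 ^ 136) (16 ^ 135) tt

HalfFamily : ℕ → Set
HalfFamily d = Σ[ F ∈ (Fin d → Subset d) ]
                 ((∀ (k : Fin d) → ∣ F k ∣ ≡ ⌈ d /2⌉)
                 × (∀ (k k′ : Fin d) → k <ᶠ k′ → 26 * ∣ F k ∩ F k′ ∣ < 7 * d))

module Construction (t r s : ℕ) where

  n c d : ℕ
  n = 15 ^ t
  c = ⌈ s /2⌉
  d = r * (n * 2) + s

  instance
    block-nonZero : NonZero (n * 2)
    block-nonZero = ℕₚ.m*n≢0 n 2 {{ℕₚ.m^n≢0 15 t}}

  member : ℕ → ℕ → Bool
  member k = layout (n * 2) r c (double (word t k))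

  family : Fin d → Subset d
  family k = subset d (member (toℕ k))

  meet : ∀ k k′ →
    + ∣ family k ∩ family k′ ∣ ≡ + r *ℤ agreements n (word t (toℕ k)) (word t (toℕ k′)) +ℤ + c
  meet k k′ = begin
    + ∣ family k ∩ family k′ ∣
      ≡⟨ cong (λ S → + ∣ S ∣) (subset-∩ d (member (toℕ k)) (member (toℕ k′))) ⟩
    + ∣ subset d (λ p → member (toℕ k) p ∧ member (toℕ k′) p) ∣
      ≡⟨ subset-size d _ ⟩
    count d (λ p → member (toℕ k) p ∧ member (toℕ k′) p)
      ≡⟨ layout-overlap (n * 2) r c s (double (word t (toℕ k))) (double (word t (toℕ k′))) (ℕₚ.⌈n/2⌉≤n s) ⟩
    + r *ℤ count (n * 2) (λ z → double (word t (toℕ k)) z ∧ double (word t (toℕ k′)) z) +ℤ + c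
      ≡⟨ cong (λ A → + r *ℤ A +ℤ + c) (double-overlap n (word t (toℕ k)) (word t (toℕ k′))) ⟩
    + r *ℤ agreements n (word t (toℕ k)) (word t (toℕ k′)) +ℤ + c ∎
    where open ≡-Reasoning

  family-size : ∀ k → ∣ family k ∣ ≡ ⌈ d /2⌉
  family-size k = ℤₚ.+-injective (begin
    + ∣ family k ∣                ≡⟨ cong (λ S → + ∣ S ∣) (sym (∩-idem (family k))) ⟩
    + ∣ family k ∩ family k ∣     ≡⟨ meet k k ⟩
    + r *ℤ agreements n w w +ℤ + c ≡⟨ cong (λ A → + r *ℤ A +ℤ + c) (agreements-self n w) ⟩
    + r *ℤ + n +ℤ + c              ≡⟨ cong (_+ℤ + c) (sym (ℤₚ.pos-* r n)) ⟩
    + (r * n + c)                  ≡⟨ cong +_ (sym half-d) ⟩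
    + ⌈ d /2⌉                      ∎)
    where
    open ≡-Reasoning
    w : ℕ → Bool
    w = word t (toℕ k)
    half-d : ⌈ d /2⌉ ≡ r * n + c
    half-d = trans (cong (λ x → ⌈ x + s /2⌉) (sym (ℕₚ.*-assoc r n 2))) (⌈even+s/2⌉ (r * n) s)

  family-overlap : d ≤ 16 ^ t → s < n * 2 → 200 ≤ r →
    ∀ k k′ → k <ᶠ k′ → 26 * ∣ family k ∩ family k′ ∣ < 7 * d
  family-overlap d≤16^t s<2n 200≤r k k′ k<k′ = begin-strict
    26 * X              <⟨ margin X r n c (overlap-bound X r A c n I X≡ 2A≡ 15I≤n) c≤n (ℕₚ.m^n>0 15 t) 200≤r ⟩
    14 * (r * n)        ≡⟨ rearrange r n ⟩
    7 * (r * (n * 2))   ≤⟨ ℕₚ.*-monoʳ-≤ 7 (ℕₚ.m≤m+n (r * (n * 2)) s) ⟩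
    7 * d               ∎
    where
    open ℕₚ.≤-Reasoning
    rearrange : ∀ r n → 14 * (r * n) ≡ 7 * (r * (n * 2))
    rearrange = solve-∀
    X : ℕ
    X = ∣ family k ∩ family k′ ∣
    A I : ℤ
    A = agreements n (word t (toℕ k)) (word t (toℕ k′))
    I = corr t (toℕ k) (toℕ k′)
    c≤n : c ≤ n
    c≤n = ⌈s/2⌉≤n n s s<2n
    X≡ : + X ≡ + r *ℤ A +ℤ + c
    X≡ = meet k k′
    2A≡ : + 2 *ℤ A ≡ + n +ℤ I
    2A≡ = agreements-inner n (word t (toℕ k)) (word t (toℕ k′))
    15I≤n : + 15 *ℤ I ≤ℤ + n
    15I≤n = proj₂ (corr-window 3 (ℕₚ.m≤m+n 9 6) baseCode-window t (toℕ k) (toℕ k′)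
              (ℕₚ.<-≤-trans (Finₚ.toℕ<n k) d≤16^t) (ℕₚ.<-≤-trans (Finₚ.toℕ<n k′) d≤16^t)
              (ℕₚ.<⇒≢ k<k′))

half-family : ∀ d t → 400 * 15 ^ t ≤ d → d ≤ 16 ^ t → HalfFamily d
half-family d t 400·15^t≤d d≤16^t =
  subst HalfFamily (sym d≡) (family , family-size ,
    family-overlap (subst (_≤ 16 ^ t) d≡ d≤16^t) (m%n<n d m) 200≤r)
  where
  m : ℕ
  m = 15 ^ t * 2
  instance
    m-nonZero : NonZero m
    m-nonZero = ℕₚ.m*n≢0 (15 ^ t) 2 {{ℕₚ.m^n≢0 15 t}}
  open Construction t (d / m) (d % m) using (family; family-size; family-overlap)
  d≡ : d ≡ Construction.d t (d / m) (d % m)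
  d≡ = trans (m≡m%n+[m/n]*n d m) (ℕₚ.+-comm (d % m) (d / m * m))
  200≤r : 200 ≤ d / m
  200≤r = subst (_≤ d / m) (m*n/n≡m 200 m)
            (/-monoˡ-≤ m (subst (_≤ d) (regroup (15 ^ t)) 400·15^t≤d))
    where
    regroup : ∀ x → 400 * x ≡ 200 * (x * 2)
    regroup = solve-∀

fact2 : ∃ λ (d₀ : ℕ) → ∀ (d : ℕ) → d ≥ d₀ →
          Σ[ F ∈ (Fin d → Subset d) ]
            ((∀ (k : Fin d) → ∣ F k ∣ ≡ ⌈ d /2⌉)
            × (∀ (k k′ : Fin d) → k <ᶠ k′ → 26 * ∣ F k ∩ F k′ ∣ < 7 * d))
fact2 = suc (16 ^ 135) , λ d d>16^135 →
  let (t , lower , upper) = exponent-for d d>16^135 in half-family d t lower upper
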